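{- Let $c\ge 1$ and $n_1\ge n_2\ge\cdots\ge n_c\ge 1$ be integers. Let $G$ be a finite simple graph whose edges are each colored with one of the colors $1,\ldots,c$. Suppose there is a partition $\{V_1,V_2,\ldots,V_n\}$ of $V(G)$ such that for all $i\neq j$ there is at least one edge of $G$ with one end in $V_i$ and the other in $V_j$, and $n\ge n_1+1+\sum_{i=1}^{c}(n_i-1)$. Then for some $i\in\{1,\ldots,c\}$, $G$ contains a matching of $n_i$ edges all of color $i$.
   Context: $n_iK_2$ denotes a matching of $n_i$ pairwise vertex-disjoint edges. -}

module Defs where

open import Data.Nat using (ℕ; _≤_; _∸_; _+_)
open import Data.Fin using (Fin; toℕ)
open import Data.Maybe using (Maybe; just; nothing)
open import Data.Product using (Σ; _×_; _,_; proj₁; proj₂; ∃-syntax)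
open import Data.List using (tabulate)
open import Data.Nat.ListAction using (sum)
open import Relation.Binary.PropositionalEquality using (_≡_; _≢_)

-- A finite simple graph on vertex set Fin N whose edges are each coloured
-- with one of c colours (Fin c).  edge u v = just k means uv is an edge of
-- colour k; nothing means u and v are not adjacent.
record ColouredGraph (N c : ℕ) : Set where
  field
    edge   : Fin N → Fin N → Maybe (Fin c)
    sym    : ∀ u v → edge u v ≡ edge v u
    irrefl : ∀ v → edge v v ≡ nothing
open ColouredGraph public

Adjacent : ∀ {N c} → ColouredGraph N c → Fin N → Fin N → Set
Adjacent G u v = edge G u v ≢ nothing

-- A partition {V_1,...,V_n} of V(G) into n (nonempty) blocks, given by the
-- block-assignment map; surjectivity = every block is nonempty.
record Partition (N n : ℕ) : Set where
  field
    block    : Fin N → Fin n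
    nonempty : ∀ i → ∃[ v ] block v ≡ i
open Partition public

AllPairsJoined : ∀ {N c n} → ColouredGraph N c → Partition N n → Set
AllPairsJoined {N} {c} {n} G P =
  ∀ (i j : Fin n) → i ≢ j →
    ∃[ u ] ∃[ v ] (block P u ≡ i × block P v ≡ j × Adjacent G u v)

Disjoint : ∀ {N} → Fin N × Fin N → Fin N × Fin N → Set
Disjoint (u , v) (x , y) = u ≢ x × u ≢ y × v ≢ x × v ≢ y

MonoMatching : ∀ {N c} → ColouredGraph N c → Fin c → ℕ → Set
MonoMatching {N} G i k =
  Σ (Fin k → Fin N × Fin N) λ m →
    (∀ a → edge G (proj₁ (m a)) (proj₂ (m a)) ≡ just i) ×
    (∀ a b → a ≢ b → Disjoint (m a) (m b))

ΣFin : ∀ c → (Fin c → ℕ) → ℕ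
ΣFin c f = sum (tabulate f)

-- Choosing for every pair of blocks the colour of one edge between them turns the blocks into
-- a coloured complete graph K_n; a monochromatic matching there lifts to G because distinct
-- blocks are disjoint.
--
-- For K_n we induct on M + Σ (n_i - 1), where every n_i ≤ M and n ≥ M + 1 + Σ (n_i - 1),
-- keeping track of the set A of vertices still available. If a colour occurring in A needs at
-- most one edge we are done. Otherwise, walking from vertex to vertex, either some x ∈ A sees
-- every colour occurring in A, or A contains a rainbow triangle, or a 4-cycle x w u v whose
-- opposite edges w u and v x share a colour a while x w and u v carry two other, distinct
-- colours. Removing x with one neighbour of each colour lowers M and each occurring n_i by
-- one; removing the triangle lowers its three n_i by one; removing the 4-cycle lowers n_a by two
-- and the two other n_i by one (and if n_a = 2 the two a-edges already suffice). Each time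
-- the counting hypothesis survives, and a matching in the rest extends by removed edges.

module Submission where

open import Defs hiding (sym)
open import Data.Nat as ℕ using (ℕ; _≤_; _<_; _∸_; _+_; suc; z≤n; s≤s; _≤?_)
import Data.Nat.Properties as ℕ
open import Data.Nat.Induction using (<-wellFounded)
open import Induction.WellFounded using (Acc; acc)
open import Data.Fin as Fin using (Fin; toℕ; zero; suc; _≟_)
import Data.Fin.Properties as Fin
open import Data.Fin.Subset using (Subset; inside; outside; _∈_; _∉_; _⊆_; _-_; ∣_∣; ⊤; Nonempty)
open import Data.Fin.Subset.Properties using (_∈?_; p─⊥≡p; p─q⊆p; x∈p∧x≢y⇒x∈p-y; ∣⊤∣≡n)
open import Data.Vec using (here; there; _∷_)
open import Data.Maybe using (Maybe; just; nothing; fromMaybe)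
open import Data.Product using (Σ; ∃-syntax; _×_; _,_; proj₁; proj₂; map₂)
open import Data.Sum using (_⊎_; inj₁; inj₂; map₁)
open import Data.Empty using (⊥-elim)
open import Data.List using (List; []; _∷_; length; tabulate; allFin; catMaybes)
open import Data.List.Membership.Propositional using () renaming (_∈_ to _∈ˡ_)
open import Data.List.Membership.Propositional.Properties using (∈-allFin)
import Data.List.Relation.Unary.Any as Any
open import Data.List.Relation.Unary.All as All using (All; all?)
open import Data.List.Relation.Unary.All.Properties using (¬All⇒Any¬)
open import Relation.Nullary using (Dec; yes; no; ¬_)
open import Relation.Nullary.Decidable using (_×-dec_; _→-dec_; ¬?)
open import Relation.Binary using (tri<; tri≈; tri>)
open import Relation.Binary.PropositionalEquality
open import Function using (_∘_)
open import Algebra.Properties.CommutativeSemigroup ℕ.+-commutativeSemigroup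
  using () renaming (interchange to +-interchange)

private variable
  n : ℕ

∣p∣≤1+∣p-x∣ : ∀ (p : Subset n) x → ∣ p ∣ ≤ suc ∣ p - x ∣
∣p∣≤1+∣p-x∣ (inside ∷ p) zero = ℕ.≤-reflexive (cong (suc ∘ ∣_∣) (sym (p─⊥≡p p)))
∣p∣≤1+∣p-x∣ (outside ∷ p) zero = ℕ.m≤n⇒m≤1+n (ℕ.≤-reflexive (cong ∣_∣ (sym (p─⊥≡p p))))
∣p∣≤1+∣p-x∣ (inside ∷ p) (suc x) = s≤s (∣p∣≤1+∣p-x∣ p x)
∣p∣≤1+∣p-x∣ (outside ∷ p) (suc x) = ∣p∣≤1+∣p-x∣ p x

x∉p-x : ∀ (p : Subset n) x → x ∉ p - x
x∉p-x (_ ∷ p) zero ()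
x∉p-x (_ ∷ p) (suc x) (there x∈p-x) = x∉p-x p x x∈p-x

∣p∣>0⇒nonempty : ∀ (p : Subset n) → 1 ≤ ∣ p ∣ → Nonempty p
∣p∣>0⇒nonempty (inside ∷ p) _ = zero , here
∣p∣>0⇒nonempty (outside ∷ p) 1≤∣p∣ with ∣p∣>0⇒nonempty p 1≤∣p∣
... | x , x∈p = suc x , there x∈p

∈∧∉⇒≢ : ∀ {p : Subset n} {y z} → y ∈ p → z ∉ p → y ≢ z
∈∧∉⇒≢ y∈p z∉p refl = z∉p y∈p

removeAll : Subset n → List (Fin n) → Subset n
removeAll p [] = p
removeAll p (x ∷ xs) = removeAll (p - x) xs

removeAll-⊆ : ∀ (p : Subset n) xs → removeAll p xs ⊆ p
removeAll-⊆ p [] y∈ = y∈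
removeAll-⊆ p (x ∷ xs) y∈ = p─q⊆p p _ (removeAll-⊆ (p - x) xs y∈)

∈ˡ⇒∉removeAll : ∀ (p : Subset n) xs {y} → y ∈ˡ xs → y ∉ removeAll p xs
∈ˡ⇒∉removeAll p (y ∷ xs) (Any.here refl) = x∉p-x p y ∘ removeAll-⊆ (p - y) xs
∈ˡ⇒∉removeAll p (x ∷ xs) (Any.there y∈xs) = ∈ˡ⇒∉removeAll (p - x) xs y∈xs

∣p∣≤∣xs∣+∣removeAll∣ : ∀ (p : Subset n) xs → ∣ p ∣ ≤ length xs + ∣ removeAll p xs ∣
∣p∣≤∣xs∣+∣removeAll∣ p [] = ℕ.≤-refl
∣p∣≤∣xs∣+∣removeAll∣ p (x ∷ xs) =
  ℕ.≤-trans (∣p∣≤1+∣p-x∣ p x) (s≤s (∣p∣≤∣xs∣+∣removeAll∣ (p - x) xs))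

size : {X : Set} → Maybe X → ℕ
size (just _) = 1
size nothing = 0

length-catMaybes-tabulate : ∀ {C} {X : Set} (f : Fin C → Maybe X) →
  length (catMaybes (tabulate f)) ≡ ΣFin C (size ∘ f)
length-catMaybes-tabulate {ℕ.zero} f = refl
length-catMaybes-tabulate {suc C} f with f zero
... | just _ = cong suc (length-catMaybes-tabulate (f ∘ suc))
... | nothing = length-catMaybes-tabulate (f ∘ suc)

∈-catMaybes-tabulate : ∀ {C} {X : Set} (f : Fin C → Maybe X) i {y} →
  f i ≡ just y → y ∈ˡ catMaybes (tabulate f)
∈-catMaybes-tabulate f zero eq rewrite eq = Any.here refl
∈-catMaybes-tabulate f (suc i) eq with f zero
... | just _ = Any.there (∈-catMaybes-tabulate (f ∘ suc) i eq)
... | nothing = ∈-catMaybes-tabulate (f ∘ suc) i eq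

ΣFin-+ : ∀ C (f g : Fin C → ℕ) → ΣFin C (λ i → f i + g i) ≡ ΣFin C f + ΣFin C g
ΣFin-+ ℕ.zero f g = refl
ΣFin-+ (suc C) f g =
  trans (cong (f zero + g zero +_) (ΣFin-+ C (f ∘ suc) (g ∘ suc))) (+-interchange (f zero) (g zero) _ _)

ΣFin-mono : ∀ C {f g : Fin C → ℕ} → (∀ i → f i ≤ g i) → ΣFin C f ≤ ΣFin C g
ΣFin-mono ℕ.zero f≤g = z≤n
ΣFin-mono (suc C) f≤g = ℕ.+-mono-≤ (f≤g zero) (ΣFin-mono C (f≤g ∘ suc))

ΣFin-0 : ∀ C → ΣFin C (λ _ → 0) ≡ 0
ΣFin-0 ℕ.zero = refl
ΣFin-0 (suc C) = ΣFin-0 C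

𝟙[_≡_] : ∀ {C} → Fin C → Fin C → ℕ
𝟙[ zero ≡ zero ] = 1
𝟙[ zero ≡ suc _ ] = 0
𝟙[ suc _ ≡ zero ] = 0
𝟙[ suc i ≡ suc j ] = 𝟙[ i ≡ j ]

𝟙-refl : ∀ {C} (i : Fin C) → 𝟙[ i ≡ i ] ≡ 1
𝟙-refl zero = refl
𝟙-refl (suc i) = 𝟙-refl i

𝟙-≢ : ∀ {C} {i j : Fin C} → i ≢ j → 𝟙[ i ≡ j ] ≡ 0
𝟙-≢ {i = zero} {zero} i≢j = ⊥-elim (i≢j refl)
𝟙-≢ {i = zero} {suc j} _ = refl
𝟙-≢ {i = suc i} {zero} _ = refl
𝟙-≢ {i = suc i} {suc j} i≢j = 𝟙-≢ (i≢j ∘ cong suc)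

ΣFin-𝟙 : ∀ C (j : Fin C) → ΣFin C (λ i → 𝟙[ i ≡ j ]) ≡ 1
ΣFin-𝟙 (suc C) zero = cong suc (ΣFin-0 C)
ΣFin-𝟙 (suc C) (suc j) = ΣFin-𝟙 C j

m∸n∸1+n≡m∸1 : ∀ {m n} → n < m → m ∸ n ∸ 1 + n ≡ m ∸ 1
m∸n∸1+n≡m∸1 {m} {n} n<m = begin
  m ∸ n ∸ 1 + n   ≡⟨ cong (_+ n) (trans (ℕ.∸-+-assoc m n 1) (cong (m ∸_) (ℕ.+-comm n 1))) ⟩
  m ∸ (1 + n) + n ≡⟨ cong (_+ n) (ℕ.∸-+-assoc m 1 n) ⟨
  m ∸ 1 ∸ n + n   ≡⟨ ℕ.m∸n+n≡m (ℕ.∸-monoˡ-≤ 1 n<m) ⟩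
  m ∸ 1           ∎
  where open ≡-Reasoning

-- Monochromatic matchings in coloured complete graphs

module CompleteColouring {C : ℕ} (col : Fin n → Fin n → Fin C) (col-sym : ∀ x y → col x y ≡ col y x)
  where

  Edge : Subset n → Fin C → Fin n × Fin n → Set
  Edge A i (u , v) = u ∈ A × v ∈ A × u ≢ v × col u v ≡ i

  Matching : Subset n → Fin C → ℕ → Set
  Matching A i k = Σ (Fin k → Fin n × Fin n) λ m →
    (∀ a → Edge A i (m a)) × (∀ a b → a ≢ b → Disjoint (m a) (m b))

  Present : Subset n → Fin C → Set
  Present A i = ∃[ u ] ∃[ v ] Edge A i (u , v)

  Sees : Subset n → Fin n → Fin C → Set
  Sees A x i = ∃[ w ] w ∈ A × w ≢ x × col x w ≡ i

  present? : ∀ A i → Dec (Present A i)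
  present? A i = Fin.any? λ u → Fin.any? λ v →
    (u ∈? A) ×-dec (v ∈? A) ×-dec ¬? (u ≟ v) ×-dec (col u v ≟ i)

  sees? : ∀ A x i → Dec (Sees A x i)
  sees? A x i = Fin.any? λ w → (w ∈? A) ×-dec ¬? (w ≟ x) ×-dec (col x w ≟ i)

  Visible : Subset n → Fin n → Fin C → Set
  Visible A x i = Present A i → Sees A x i

  visible? : ∀ A x i → Dec (Visible A x i)
  visible? A x i = present? A i →-dec sees? A x i

  record RainbowTriangle (A : Subset n) : Set where
    field
      x u w : Fin n
      x∈A : x ∈ A
      u∈A : u ∈ A
      w∈A : w ∈ A
      x≢u : x ≢ u
      u≢w : u ≢ w
      w≢x : w ≢ x
      xu≢uw : col x u ≢ col u w
      uw≢wx : col u w ≢ col w x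
      wx≢xu : col w x ≢ col x u

  record Square (A : Subset n) : Set where
    field
      x w u v : Fin n
      x∈A : x ∈ A
      w∈A : w ∈ A
      u∈A : u ∈ A
      v∈A : v ∈ A
      x≢w : x ≢ w
      x≢u : x ≢ u
      x≢v : x ≢ v
      w≢u : w ≢ u
      w≢v : w ≢ v
      u≢v : u ≢ v
      vx≡wu : col v x ≡ col w u
      xw≢wu : col x w ≢ col w u
      uv≢wu : col u v ≢ col w u
      xw≢uv : col x w ≢ col u v

  Configuration : Subset n → Set
  Configuration A = RainbowTriangle A ⊎ Square A

  -- x sees every colour of L but misses f, the colour of uv. Moving from x to u gains f, and a
  -- colour of L lost on the way forces a configuration.
  module Transfer {A : Subset n} {x u v : Fin n} {f : Fin C}
    (x∈A : x ∈ A) (x-misses-f : ¬ Sees A x f) (uv : Edge A f (u , v)) where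

    private
      u∈A = proj₁ uv
      v∈A = proj₁ (proj₂ uv)
      u≢v = proj₁ (proj₂ (proj₂ uv))
      uv≡f = proj₂ (proj₂ (proj₂ uv))

    x≢u : x ≢ u
    x≢u refl = x-misses-f (v , v∈A , u≢v ∘ sym , uv≡f)

    x≢v : x ≢ v
    x≢v refl = x-misses-f (u , u∈A , u≢v , trans (col-sym v u) uv≡f)

    xu≢f : col x u ≢ f
    xu≢f xu≡f = x-misses-f (u , u∈A , x≢u ∘ sym , xu≡f)

    xv≢f : col x v ≢ f
    xv≢f xv≡f = x-misses-f (v , v∈A , x≢v ∘ sym , xv≡f)

    rainbow : col x u ≢ col x v → RainbowTriangle A
    rainbow xu≢xv = record
      { x = x ; u = u ; w = v ; x∈A = x∈A ; u∈A = u∈A ; w∈A = v∈A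
      ; x≢u = x≢u ; u≢w = u≢v ; w≢x = x≢v ∘ sym
      ; xu≢uw = xu≢f ∘ (λ e → trans e uv≡f)
      ; uw≢wx = λ e → xv≢f (trans (col-sym x v) (trans (sym e) uv≡f))
      ; wx≢xu = λ e → xu≢xv (trans (sym e) (col-sym v x))
      }

    missed-colour⇒configuration : col x u ≡ col x v → ∀ {i} → Sees A x i → ¬ Sees A u i →
                                  Configuration A
    missed-colour⇒configuration xu≡xv {i} (w , w∈A , w≢x , xw≡i) u-misses-i with col u w ≟ col x u
    ... | yes uw≡xu = inj₂ record
      { x = x ; w = w ; u = u ; v = v ; x∈A = x∈A ; w∈A = w∈A ; u∈A = u∈A ; v∈A = v∈A
      ; x≢w = w≢x ∘ sym ; x≢u = x≢u ; x≢v = x≢v ; w≢u = w≢u ; w≢v = w≢v ; u≢v = u≢v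
      ; vx≡wu = trans (col-sym v x) (trans (sym xu≡xv) (trans (sym uw≡xu) (col-sym u w)))
      ; xw≢wu = λ e → i≢xu (trans (sym xw≡i) (trans e (trans (col-sym w u) uw≡xu)))
      ; uv≢wu = λ e → xu≢f (trans (sym uw≡xu) (trans (col-sym u w) (trans (sym e) uv≡f)))
      ; xw≢uv = λ e → x-misses-f (w , w∈A , w≢x , trans e uv≡f)
      }
      where
      i≢xu : i ≢ col x u
      i≢xu i≡xu = u-misses-i (x , x∈A , x≢u , trans (col-sym u x) (sym i≡xu))
      w≢u : w ≢ u
      w≢u refl = i≢xu (sym xw≡i)
      w≢v : w ≢ v
      w≢v refl = i≢xu (trans (sym xw≡i) (sym xu≡xv))
    ... | no uw≢xu = inj₁ record
      { x = x ; u = u ; w = w ; x∈A = x∈A ; u∈A = u∈A ; w∈A = w∈A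
      ; x≢u = x≢u ; u≢w = u≢w ; w≢x = w≢x
      ; xu≢uw = uw≢xu ∘ sym
      ; uw≢wx = λ e → u-misses-i (w , w∈A , u≢w ∘ sym , trans e (trans (col-sym w x) xw≡i))
      ; wx≢xu = λ e → u-misses-i
          (x , x∈A , x≢u , trans (col-sym u x) (trans (sym e) (trans (col-sym w x) xw≡i)))
      }
      where
      u≢w : u ≢ w
      u≢w refl = u-misses-i (x , x∈A , x≢u , trans (col-sym u x) xw≡i)

    transfer : ∀ L → All (Visible A x) L → All (Visible A u) (f ∷ L) ⊎ Configuration A
    transfer L x-sees-L with col x u ≟ col x v
    ... | no xu≢xv = inj₂ (inj₁ (rainbow xu≢xv))
    ... | yes xu≡xv with all? (visible? A u) L
    ...   | yes u-sees-L = inj₁ ((λ _ → v , v∈A , u≢v ∘ sym , uv≡f) All.∷ u-sees-L)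
    ...   | no ¬u-sees-L with All.lookupAny x-sees-L (¬All⇒Any¬ (visible? A u) L ¬u-sees-L)
    ...     | x-vis , ¬u-vis with present? A _
    ...       | yes pr = inj₂ (missed-colour⇒configuration xu≡xv (x-vis pr) (λ s → ¬u-vis (λ _ → s)))
    ...       | no ¬pr = ⊥-elim (¬u-vis (⊥-elim ∘ ¬pr))

  universal-or-configuration : ∀ A → Nonempty A →
    (∃[ x ] x ∈ A × (∀ i → Visible A x i)) ⊎ Configuration A
  universal-or-configuration A A≠∅ = map₁ lookup-all (sees-all-or-configuration (allFin C))
    where
    lookup-all : (∃[ x ] x ∈ A × All (Visible A x) (allFin C)) → ∃[ x ] x ∈ A × (∀ i → Visible A x i)
    lookup-all (x , x∈A , x-sees) = x , x∈A , λ i → All.lookup x-sees (∈-allFin i)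

    sees-all-or-configuration : ∀ L → (∃[ x ] x ∈ A × All (Visible A x) L) ⊎ Configuration A
    sees-all-or-configuration [] = inj₁ (proj₁ A≠∅ , proj₂ A≠∅ , All.[])
    sees-all-or-configuration (f ∷ L) with sees-all-or-configuration L
    ... | inj₂ cfg = inj₂ cfg
    ... | inj₁ (x , x∈A , x-sees-L) with sees? A x f | present? A f
    ...   | yes s | _ = inj₁ (x , x∈A , (λ _ → s) All.∷ x-sees-L)
    ...   | no _ | no ¬pr = inj₁ (x , x∈A , (⊥-elim ∘ ¬pr) All.∷ x-sees-L)
    ...   | no ¬s | yes (u , v , uv) =
      map₁ (λ u-sees → u , proj₁ uv , u-sees) (Transfer.transfer x∈A ¬s uv L x-sees-L)

  no-matching : ∀ {A i} → Matching A i 0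
  no-matching = (λ ()) , (λ ()) , (λ ())

  single-edge : ∀ {A i e} → Edge A i e → Matching A i 1
  single-edge e = (λ _ → _) , (λ _ → e) , λ { zero zero 0≢0 → ⊥-elim (0≢0 refl) }

  at-most-one-edge : ∀ {A i k} → Present A i → k ≤ 1 → Matching A i k
  at-most-one-edge {k = ℕ.zero} _ _ = no-matching
  at-most-one-edge {k = suc ℕ.zero} (_ , _ , e) _ = single-edge e
  at-most-one-edge {k = suc (suc _)} _ (s≤s ())

  edge-mono : ∀ {A B i e} → A ⊆ B → Edge A i e → Edge B i e
  edge-mono A⊆B (u∈A , v∈A , u≢v , uv≡i) = A⊆B u∈A , A⊆B v∈A , u≢v , uv≡i

  matching-mono : ∀ {A B i k} → A ⊆ B → Matching A i k → Matching B i k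
  matching-mono A⊆B (m , edges , disjoint) = m , edge-mono A⊆B ∘ edges , disjoint

  matching⇒present : ∀ {A i k} → Matching A i (suc k) → Present A i
  matching⇒present (m , edges , _) = proj₁ (m zero) , proj₂ (m zero) , edges zero

  extend : ∀ {A′ A i k u v} → A′ ⊆ A → Edge A i (u , v) → u ∉ A′ → v ∉ A′ →
           Matching A′ i k → Matching A i (suc k)
  extend {A′} {A} {i} {k} {u} {v} A′⊆A uv u∉A′ v∉A′ (m , edges , disjoint) =
    m′ , edges′ , disjoint′
    where
    m′ : Fin (suc k) → Fin n × Fin n
    m′ zero = u , v
    m′ (suc a) = m a

    edges′ : ∀ a → Edge A i (m′ a)
    edges′ zero = uv
    edges′ (suc a) = edge-mono A′⊆A (edges a)

    new-old : ∀ b → Disjoint (u , v) (m b)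
    new-old b with edges b
    ... | p∈A′ , q∈A′ , _ = ≢-sym (∈∧∉⇒≢ p∈A′ u∉A′) , ≢-sym (∈∧∉⇒≢ q∈A′ u∉A′)
                          , ≢-sym (∈∧∉⇒≢ p∈A′ v∉A′) , ≢-sym (∈∧∉⇒≢ q∈A′ v∉A′)

    disjoint′ : ∀ a b → a ≢ b → Disjoint (m′ a) (m′ b)
    disjoint′ zero zero 0≢0 = ⊥-elim (0≢0 refl)
    disjoint′ zero (suc b) _ = new-old b
    disjoint′ (suc a) zero _ with new-old a
    ... | u≢p , u≢q , v≢p , v≢q = ≢-sym u≢p , ≢-sym v≢p , ≢-sym u≢q , ≢-sym v≢q
    disjoint′ (suc a) (suc b) a≢b = disjoint a b (a≢b ∘ cong suc)

  RemovedEdge : Subset n → Subset n → Fin C → Set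
  RemovedEdge A A′ i = ∃[ u ] ∃[ v ] Edge A i (u , v) × u ∉ A′ × v ∉ A′

  removed⇒present : ∀ {A A′ i} → RemovedEdge A A′ i → Present A i
  removed⇒present (u , v , uv , _) = u , v , uv

  Payable : Subset n → Subset n → Fin C → ℕ → Set
  Payable A A′ i d = d ≡ 0 ⊎ (d ≡ 1 × RemovedEdge A A′ i)

  lift-payable : ∀ {A A′ i k d} → A′ ⊆ A → Payable A A′ i d → (Present A i → 2 ≤ k) →
                 Matching A′ i (k ∸ d) → Matching A i k
  lift-payable A′⊆A (inj₁ refl) _ = matching-mono A′⊆A
  lift-payable {k = suc k} A′⊆A (inj₂ (refl , u , v , uv , u∉A′ , v∉A′)) _ =
    extend A′⊆A uv u∉A′ v∉A′
  lift-payable {k = ℕ.zero} _ (inj₂ (refl , e)) 2≤k with 2≤k (removed⇒present e)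
  ... | ()

  S : (Fin C → ℕ) → ℕ
  S ns = ΣFin C (λ i → ns i ∸ 1)

  S-budget : ∀ {ns ns′ d} → (∀ i → ns′ i ∸ 1 + d i ≤ ns i ∸ 1) → S ns′ + ΣFin C d ≤ S ns
  S-budget {ns′ = ns′} {d} pays =
    ℕ.≤-trans (ℕ.≤-reflexive (sym (ΣFin-+ C (λ i → ns′ i ∸ 1) d))) (ΣFin-mono C pays)

  pays-payable : ∀ {A A′ i k d} → Payable A A′ i d → (Present A i → 2 ≤ k) →
                 k ∸ d ∸ 1 + d ≤ k ∸ 1
  pays-payable (inj₁ refl) _ = ℕ.≤-reflexive (ℕ.+-identityʳ _)
  pays-payable (inj₂ (refl , e)) 2≤k = ℕ.≤-reflexive (m∸n∸1+n≡m∸1 (2≤k (removed⇒present e)))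

  Goal : Subset n → (Fin C → ℕ) → Set
  Goal A ns = ∃[ i ] Matching A i (ns i)

  Solvable : Subset n → (Fin C → ℕ) → ℕ → Set
  Solvable A ns M = (∀ i → ns i ≤ M) → suc (M + S ns) ≤ ∣ A ∣ → Goal A ns

  SolvableBelow : (Fin C → ℕ) → ℕ → Set
  SolvableBelow ns M = ∀ A′ ns′ M′ → M′ + S ns′ < M + S ns → Solvable A′ ns′ M′

  record Reduction (A : Subset n) (ns : Fin C → ℕ) (M : ℕ) : Set where
    field
      A′ : Subset n
      ns′ : Fin C → ℕ
      M′ removed : ℕ
      removes : ∣ A ∣ ≤ removed + ∣ A′ ∣
      removes-some : 1 ≤ removed
      ns′≤M′ : ∀ i → ns′ i ≤ M′
      budget : M′ + S ns′ + removed ≤ M + S ns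
      lift : ∀ i → Matching A′ i (ns′ i) → Matching A i (ns i)

  reduce : ∀ {A ns M} → SolvableBelow ns M → suc (M + S ns) ≤ ∣ A ∣ → Reduction A ns M → Goal A ns
  reduce {A} {ns} {M} solve ample r = map₂ (lift _) (solve A′ ns′ M′ decreases ns′≤M′ ample′)
    where
    open Reduction r
    open ℕ.≤-Reasoning
    decreases : M′ + S ns′ < M + S ns
    decreases = ℕ.≤-trans (ℕ.m<m+n (M′ + S ns′) removes-some) budget
    ample′ : suc (M′ + S ns′) ≤ ∣ A′ ∣
    ample′ = ℕ.+-cancelˡ-≤ removed _ _ (begin
      removed + suc (M′ + S ns′) ≡⟨ ℕ.+-comm removed _ ⟩
      suc (M′ + S ns′ + removed) ≤⟨ s≤s budget ⟩
      suc (M + S ns)             ≤⟨ ample ⟩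
      ∣ A ∣                      ≤⟨ removes ⟩
      removed + ∣ A′ ∣           ∎)

  module Star {A : Subset n} {ns : Fin C → ℕ} {M : ℕ} {x : Fin n}
              (x∈A : x ∈ A) (universal : ∀ i → Visible A x i)
              (demanding : ∀ i → Present A i → 2 ≤ ns i) (ns≤M : ∀ i → ns i ≤ M) (2≤M : 2 ≤ M) where

    witness : Fin C → Maybe (Fin n)
    witness i with sees? A x i
    ... | yes (w , _) = just w
    ... | no _ = nothing

    witness-edge : ∀ i {w} → witness i ≡ just w → Edge A i (x , w)
    witness-edge i eq with sees? A x i
    witness-edge i refl | yes (w , w∈A , w≢x , xw≡i) = x∈A , w∈A , w≢x ∘ sym , xw≡i

    no-witness⇒absent : ∀ i → witness i ≡ nothing → ¬ Present A i
    no-witness⇒absent i eq with sees? A x i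
    no-witness⇒absent i () | yes _
    no-witness⇒absent i eq | no ¬sees = ¬sees ∘ universal i

    witnesses : List (Fin n)
    witnesses = catMaybes (tabulate witness)

    A′ : Subset n
    A′ = removeAll A (x ∷ witnesses)

    A′⊆A : A′ ⊆ A
    A′⊆A = removeAll-⊆ A (x ∷ witnesses)

    removed-edge : ∀ i {w} → witness i ≡ just w → RemovedEdge A A′ i
    removed-edge i eq = x , _ , witness-edge i eq , ∈ˡ⇒∉removeAll A (x ∷ witnesses) (Any.here refl)
                      , ∈ˡ⇒∉removeAll A (x ∷ witnesses) (Any.there (∈-catMaybes-tabulate witness i eq))

    -- A colour x does not see is absent from A, so a demand of one edge of it is never met in A′;
    -- demanding 1 rather than ns i keeps ns′ bounded by M ∸ 1.
    demand-after : Maybe (Fin n) → ℕ → ℕ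
    demand-after (just _) k = k ∸ 1
    demand-after nothing _ = 1

    ns′ : Fin C → ℕ
    ns′ i = demand-after (witness i) (ns i)

    ns′≤M∸1 : ∀ i → ns′ i ≤ M ∸ 1
    ns′≤M∸1 i with witness i
    ... | just _ = ℕ.∸-monoˡ-≤ 1 (ns≤M i)
    ... | nothing = ℕ.∸-monoˡ-≤ 1 2≤M

    lift : ∀ i → Matching A′ i (ns′ i) → Matching A i (ns i)
    lift i = lift-witness (witness i) refl
      where
      lift-witness : ∀ mw → witness i ≡ mw → Matching A′ i (demand-after mw (ns i)) → Matching A i (ns i)
      lift-witness (just w) eq = lift-payable {k = ns i} A′⊆A (inj₂ (refl , removed-edge i eq)) (demanding i)
      lift-witness nothing eq m =
        ⊥-elim (no-witness⇒absent i eq (matching⇒present (matching-mono A′⊆A m)))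

    pays : ∀ i → ns′ i ∸ 1 + size (witness i) ≤ ns i ∸ 1
    pays i = pays-witness (witness i) refl
      where
      pays-witness : ∀ mw → witness i ≡ mw → demand-after mw (ns i) ∸ 1 + size mw ≤ ns i ∸ 1
      pays-witness (just w) eq = pays-payable {k = ns i} (inj₂ (refl , removed-edge i eq)) (demanding i)
      pays-witness nothing _ = z≤n

    budget : M ∸ 1 + S ns′ + suc (length witnesses) ≤ M + S ns
    budget = begin
      M ∸ 1 + S ns′ + suc (length witnesses)      ≡⟨ ℕ.+-suc (M ∸ 1 + S ns′) _ ⟩
      suc (M ∸ 1 + S ns′ + length witnesses)      ≡⟨ cong suc (ℕ.+-assoc (M ∸ 1) _ _) ⟩
      suc (M ∸ 1) + (S ns′ + length witnesses)    ≡⟨ cong₂ _+_ (ℕ.m+[n∸m]≡n (ℕ.≤-trans (s≤s z≤n) 2≤M))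
                                                        (cong (S ns′ +_) (length-catMaybes-tabulate witness)) ⟩
      M + (S ns′ + ΣFin C (size ∘ witness))       ≤⟨ ℕ.+-monoʳ-≤ M (S-budget {ns} {ns′} pays) ⟩
      M + S ns                                    ∎
      where open ℕ.≤-Reasoning

    reduction : Reduction A ns M
    reduction = record
      { A′ = A′ ; ns′ = ns′ ; M′ = M ∸ 1 ; removed = suc (length witnesses)
      ; removes = ∣p∣≤∣xs∣+∣removeAll∣ A (x ∷ witnesses) ; removes-some = s≤s z≤n
      ; ns′≤M′ = ns′≤M∸1 ; budget = budget ; lift = lift }

  module Triangle {A : Subset n} {ns : Fin C → ℕ} {M : ℕ} (t : RainbowTriangle A)
                  (demanding : ∀ i → Present A i → 2 ≤ ns i) (ns≤M : ∀ i → ns i ≤ M) where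
    open RainbowTriangle t

    corners : List (Fin n)
    corners = x ∷ u ∷ w ∷ []

    A′ : Subset n
    A′ = removeAll A corners

    A′⊆A : A′ ⊆ A
    A′⊆A = removeAll-⊆ A corners

    x∉A′ : x ∉ A′
    x∉A′ = ∈ˡ⇒∉removeAll A corners (Any.here refl)
    u∉A′ : u ∉ A′
    u∉A′ = ∈ˡ⇒∉removeAll A corners (Any.there (Any.here refl))
    w∉A′ : w ∉ A′
    w∉A′ = ∈ˡ⇒∉removeAll A corners (Any.there (Any.there (Any.here refl)))

    used : Fin C → ℕ
    used i = 𝟙[ i ≡ col x u ] + 𝟙[ i ≡ col u w ] + 𝟙[ i ≡ col w x ]

    Σused≡3 : ΣFin C used ≡ 3
    Σused≡3 = begin
      ΣFin C used
        ≡⟨ ΣFin-+ C (λ i → 𝟙[ i ≡ col x u ] + 𝟙[ i ≡ col u w ]) (𝟙[_≡ col w x ]) ⟩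
      ΣFin C (λ i → 𝟙[ i ≡ col x u ] + 𝟙[ i ≡ col u w ]) + ΣFin C 𝟙[_≡ col w x ]
        ≡⟨ cong (_+ ΣFin C 𝟙[_≡ col w x ]) (ΣFin-+ C 𝟙[_≡ col x u ] 𝟙[_≡ col u w ]) ⟩
      ΣFin C 𝟙[_≡ col x u ] + ΣFin C 𝟙[_≡ col u w ] + ΣFin C 𝟙[_≡ col w x ]
        ≡⟨ cong₂ _+_ (cong₂ _+_ (ΣFin-𝟙 C (col x u)) (ΣFin-𝟙 C (col u w)))
                     (ΣFin-𝟙 C (col w x)) ⟩
      3 ∎
      where open ≡-Reasoning

    payable : ∀ i → Payable A A′ i (used i)
    payable i with i ≟ col x u | i ≟ col u w | i ≟ col w x
    ... | yes refl | _ | _ =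
      inj₂ (cong₂ _+_ (cong₂ _+_ (𝟙-refl i) (𝟙-≢ xu≢uw)) (𝟙-≢ (wx≢xu ∘ sym)) ,
            x , u , (x∈A , u∈A , x≢u , refl) , x∉A′ , u∉A′)
    ... | no i≢xu | yes refl | _ =
      inj₂ (cong₂ _+_ (cong₂ _+_ (𝟙-≢ i≢xu) (𝟙-refl i)) (𝟙-≢ uw≢wx) ,
            u , w , (u∈A , w∈A , u≢w , refl) , u∉A′ , w∉A′)
    ... | no i≢xu | no i≢uw | yes refl =
      inj₂ (cong₂ _+_ (cong₂ _+_ (𝟙-≢ i≢xu) (𝟙-≢ i≢uw)) (𝟙-refl i) ,
            w , x , (w∈A , x∈A , w≢x , refl) , w∉A′ , x∉A′)
    ... | no i≢xu | no i≢uw | no i≢wx =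
      inj₁ (cong₂ _+_ (cong₂ _+_ (𝟙-≢ i≢xu) (𝟙-≢ i≢uw)) (𝟙-≢ i≢wx))

    ns′ : Fin C → ℕ
    ns′ i = ns i ∸ used i

    pays : ∀ i → ns′ i ∸ 1 + used i ≤ ns i ∸ 1
    pays i = pays-payable {k = ns i} (payable i) (demanding i)

    budget : M + S ns′ + 3 ≤ M + S ns
    budget = begin
      M + S ns′ + 3               ≡⟨ ℕ.+-assoc M (S ns′) 3 ⟩
      M + (S ns′ + 3)             ≡⟨ cong (λ k → M + (S ns′ + k)) Σused≡3 ⟨
      M + (S ns′ + ΣFin C used)   ≤⟨ ℕ.+-monoʳ-≤ M (S-budget {ns} {ns′} pays) ⟩
      M + S ns                    ∎
      where open ℕ.≤-Reasoning

    reduction : Reduction A ns M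
    reduction = record
      { A′ = A′ ; ns′ = ns′ ; M′ = M ; removed = 3
      ; removes = ∣p∣≤∣xs∣+∣removeAll∣ A corners ; removes-some = s≤s z≤n
      ; ns′≤M′ = λ i → ℕ.≤-trans (ℕ.m∸n≤m (ns i) (used i)) (ns≤M i)
      ; budget = budget
      ; lift = λ i → lift-payable {k = ns i} A′⊆A (payable i) (demanding i) }

  module SquareCase {A : Subset n} {ns : Fin C → ℕ} {M : ℕ} (q : Square A)
                    (demanding : ∀ i → Present A i → 2 ≤ ns i) (ns≤M : ∀ i → ns i ≤ M) where
    open Square q

    a : Fin C
    a = col w u

    corners : List (Fin n)
    corners = w ∷ u ∷ v ∷ x ∷ []

    B A′ : Subset n
    B = removeAll A (w ∷ u ∷ [])
    A′ = removeAll A corners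

    B⊆A : B ⊆ A
    B⊆A = removeAll-⊆ A (w ∷ u ∷ [])
    A′⊆B : A′ ⊆ B
    A′⊆B = removeAll-⊆ B (v ∷ x ∷ [])
    A′⊆A : A′ ⊆ A
    A′⊆A = removeAll-⊆ A corners

    w∉A′ : w ∉ A′
    w∉A′ = ∈ˡ⇒∉removeAll A corners (Any.here refl)
    u∉A′ : u ∉ A′
    u∉A′ = ∈ˡ⇒∉removeAll A corners (Any.there (Any.here refl))
    v∉A′ : v ∉ A′
    v∉A′ = ∈ˡ⇒∉removeAll A corners (Any.there (Any.there (Any.here refl)))
    x∉A′ : x ∉ A′
    x∉A′ = ∈ˡ⇒∉removeAll A corners (Any.there (Any.there (Any.there (Any.here refl))))

    wu : Edge A a (w , u)
    wu = w∈A , u∈A , w≢u , refl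

    vx : Edge B a (v , x)
    vx = x∈p∧x≢y⇒x∈p-y (x∈p∧x≢y⇒x∈p-y v∈A (w≢v ∘ sym)) (u≢v ∘ sym)
       , x∈p∧x≢y⇒x∈p-y (x∈p∧x≢y⇒x∈p-y x∈A x≢w) x≢u
       , x≢v ∘ sym , vx≡wu

    two-edges : ∀ {k} → Matching A′ a k → Matching A a (suc (suc k))
    two-edges = extend B⊆A wu (∈ˡ⇒∉removeAll A (w ∷ u ∷ []) (Any.here refl))
                              (∈ˡ⇒∉removeAll A (w ∷ u ∷ []) (Any.there (Any.here refl)))
              ∘ extend A′⊆B vx v∉A′ x∉A′

    2≤ns-a : 2 ≤ ns a
    2≤ns-a = demanding a (w , u , wu)

    used : Fin C → ℕ
    used i = 𝟙[ i ≡ col x w ] + 𝟙[ i ≡ col u v ] + (𝟙[ i ≡ a ] + 𝟙[ i ≡ a ])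

    Σused≡4 : ΣFin C used ≡ 4
    Σused≡4 = begin
      ΣFin C used
        ≡⟨ ΣFin-+ C (λ i → 𝟙[ i ≡ col x w ] + 𝟙[ i ≡ col u v ]) (λ i → 𝟙[ i ≡ a ] + 𝟙[ i ≡ a ]) ⟩
      ΣFin C (λ i → 𝟙[ i ≡ col x w ] + 𝟙[ i ≡ col u v ]) + ΣFin C (λ i → 𝟙[ i ≡ a ] + 𝟙[ i ≡ a ])
        ≡⟨ cong₂ _+_ (ΣFin-+ C 𝟙[_≡ col x w ] 𝟙[_≡ col u v ]) (ΣFin-+ C 𝟙[_≡ a ] 𝟙[_≡ a ]) ⟩
      ΣFin C 𝟙[_≡ col x w ] + ΣFin C 𝟙[_≡ col u v ] + (ΣFin C 𝟙[_≡ a ] + ΣFin C 𝟙[_≡ a ])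
        ≡⟨ cong₂ _+_ (cong₂ _+_ (ΣFin-𝟙 C (col x w)) (ΣFin-𝟙 C (col u v)))
                     (cong₂ _+_ (ΣFin-𝟙 C a) (ΣFin-𝟙 C a)) ⟩
      4 ∎
      where open ≡-Reasoning

    classify : ∀ i → Payable A A′ i (used i) ⊎ (i ≡ a × used i ≡ 2)
    classify i with i ≟ col x w | i ≟ col u v | i ≟ a
    ... | yes refl | _ | _ =
      inj₁ (inj₂ (cong₂ _+_ (cong₂ _+_ (𝟙-refl i) (𝟙-≢ xw≢uv)) (cong₂ _+_ (𝟙-≢ xw≢wu) (𝟙-≢ xw≢wu)) ,
                  x , w , (x∈A , w∈A , x≢w , refl) , x∉A′ , w∉A′))
    ... | no i≢xw | yes refl | _ =
      inj₁ (inj₂ (cong₂ _+_ (cong₂ _+_ (𝟙-≢ i≢xw) (𝟙-refl i)) (cong₂ _+_ (𝟙-≢ uv≢wu) (𝟙-≢ uv≢wu)) ,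
                  u , v , (u∈A , v∈A , u≢v , refl) , u∉A′ , v∉A′))
    ... | no i≢xw | no i≢uv | yes refl =
      inj₂ (refl , cong₂ _+_ (cong₂ _+_ (𝟙-≢ i≢xw) (𝟙-≢ i≢uv)) (cong₂ _+_ (𝟙-refl i) (𝟙-refl i)))
    ... | no i≢xw | no i≢uv | no i≢a =
      inj₁ (inj₁ (cong₂ _+_ (cong₂ _+_ (𝟙-≢ i≢xw) (𝟙-≢ i≢uv)) (cong₂ _+_ (𝟙-≢ i≢a) (𝟙-≢ i≢a))))

    ns′ : Fin C → ℕ
    ns′ i = ns i ∸ used i

    lift : ∀ i → Matching A′ i (ns′ i) → Matching A i (ns i)
    lift i with classify i
    ... | inj₁ payable = lift-payable {k = ns i} A′⊆A payable (demanding i)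
    ... | inj₂ (refl , used≡2) = lift-two 2≤ns-a ∘ subst (λ d → Matching A′ a (ns a ∸ d)) used≡2
      where
      lift-two : ∀ {k} → 2 ≤ k → Matching A′ a (k ∸ 2) → Matching A a k
      lift-two {suc (suc k)} _ = two-edges
      lift-two {suc ℕ.zero} (s≤s ())

    pays : 3 ≤ ns a → ∀ i → ns′ i ∸ 1 + used i ≤ ns i ∸ 1
    pays 3≤ns-a i with classify i
    ... | inj₁ payable = pays-payable {k = ns i} payable (demanding i)
    ... | inj₂ (refl , used≡2) =
      ℕ.≤-reflexive (subst (λ d → ns a ∸ d ∸ 1 + d ≡ ns a ∸ 1) (sym used≡2)
                           (m∸n∸1+n≡m∸1 3≤ns-a))

    budget : 3 ≤ ns a → M + S ns′ + 4 ≤ M + S ns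
    budget 3≤ns-a = begin
      M + S ns′ + 4               ≡⟨ ℕ.+-assoc M (S ns′) 4 ⟩
      M + (S ns′ + 4)             ≡⟨ cong (λ k → M + (S ns′ + k)) Σused≡4 ⟨
      M + (S ns′ + ΣFin C used)   ≤⟨ ℕ.+-monoʳ-≤ M (S-budget {ns} {ns′} (pays 3≤ns-a)) ⟩
      M + S ns                    ∎
      where open ℕ.≤-Reasoning

    reduction : 3 ≤ ns a → Reduction A ns M
    reduction 3≤ns-a = record
      { A′ = A′ ; ns′ = ns′ ; M′ = M ; removed = 4
      ; removes = ∣p∣≤∣xs∣+∣removeAll∣ A corners ; removes-some = s≤s z≤n
      ; ns′≤M′ = λ i → ℕ.≤-trans (ℕ.m∸n≤m (ns i) (used i)) (ns≤M i)
      ; budget = budget 3≤ns-a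
      ; lift = lift }

    goal : SolvableBelow ns M → suc (M + S ns) ≤ ∣ A ∣ → Goal A ns
    goal solve ample with 3 ≤? ns a
    ... | yes 3≤ns-a = reduce solve ample (reduction 3≤ns-a)
    ... | no ns-a≱3 =
      a , subst (Matching A a) (ℕ.≤-antisym 2≤ns-a (ℕ.≤-pred (ℕ.≰⇒> ns-a≱3))) (two-edges no-matching)

  two-vertices⇒present : ∀ {A} → 2 ≤ ∣ A ∣ → ∃[ i ] Present A i
  two-vertices⇒present {A} 2≤∣A∣ with ∣p∣>0⇒nonempty A (ℕ.≤-trans (s≤s z≤n) 2≤∣A∣)
  ... | x , x∈A with ∣p∣>0⇒nonempty (A - x) (ℕ.≤-pred (ℕ.≤-trans 2≤∣A∣ (∣p∣≤1+∣p-x∣ A x)))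
  ... | y , y∈A-x = col x y , x , y , x∈A , p─q⊆p A _ y∈A-x , (λ { refl → x∉p-x A x y∈A-x }) , refl

  cockayne-lorimer-acc : ∀ A ns M → Acc _<_ (M + S ns) → Solvable A ns M
  cockayne-lorimer-acc A ns ℕ.zero _ ns≤0 ample with ∣p∣>0⇒nonempty A (ℕ.≤-trans (s≤s z≤n) ample)
  ... | x , _ = col x x , subst (Matching A (col x x)) (sym (ℕ.n≤0⇒n≡0 (ns≤0 (col x x)))) no-matching
  cockayne-lorimer-acc A ns (suc m) (acc smaller) ns≤M ample
    with Fin.any? (λ i → present? A i ×-dec ns i ≤? 1)
  ... | yes (i , present , ns-i≤1) = i , at-most-one-edge present ns-i≤1
  ... | no no-cheap-colour =
    by-structure (universal-or-configuration A (∣p∣>0⇒nonempty A (ℕ.≤-trans (s≤s z≤n) ample)))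
    where
    solve : SolvableBelow ns (suc m)
    solve A′ ns′ M′ lt = cockayne-lorimer-acc A′ ns′ M′ (smaller lt)

    demanding : ∀ i → Present A i → 2 ≤ ns i
    demanding i present = ℕ.≰⇒> λ ns-i≤1 → no-cheap-colour (i , present , ns-i≤1)

    2≤M : 2 ≤ suc m
    2≤M with two-vertices⇒present (ℕ.≤-trans (s≤s (s≤s z≤n)) ample)
    ... | i , present = ℕ.≤-trans (demanding i present) (ns≤M i)

    by-structure : (∃[ x ] x ∈ A × (∀ i → Visible A x i)) ⊎ Configuration A → Goal A ns
    by-structure (inj₁ (x , x∈A , universal)) =
      reduce solve ample (Star.reduction x∈A universal demanding ns≤M 2≤M)
    by-structure (inj₂ (inj₁ t)) = reduce solve ample (Triangle.reduction t demanding ns≤M)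
    by-structure (inj₂ (inj₂ q)) = SquareCase.goal q demanding ns≤M solve ample

  cockayne-lorimer : ∀ (ns : Fin C → ℕ) M → (∀ i → ns i ≤ M) → M + 1 + S ns ≤ n → Goal ⊤ ns
  cockayne-lorimer ns M ns≤M bound = cockayne-lorimer-acc ⊤ ns M (<-wellFounded _) ns≤M
    (subst₂ _≤_ (trans (ℕ.+-assoc M 1 (S ns)) (ℕ.+-suc M (S ns))) (sym (∣⊤∣≡n n)) bound)

-- Contracting the blocks of the partition

module BlockColouring {N c n} (G : ColouredGraph N (suc c)) (P : Partition N n)
                      (joined : AllPairsJoined G P) where

  Link : Fin n → Fin n → Set
  Link p q = ∃[ u ] ∃[ v ] (block P u ≡ p × block P v ≡ q × Adjacent G u v)

  colour-between : ∀ {p q} → Link p q → Fin (suc c)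
  colour-between (u , v , _) = fromMaybe zero (edge G u v)

  colour-between-correct : ∀ {p q} (l : Link p q) →
                           edge G (proj₁ l) (proj₁ (proj₂ l)) ≡ just (colour-between l)
  colour-between-correct (u , v , _ , _ , adjacent) with edge G u v
  ... | just k = refl
  ... | nothing = ⊥-elim (adjacent refl)

  ordered : (p q : Fin n) → p Fin.< q → Fin (suc c)
  ordered p q p<q = colour-between (joined p q (Fin.<⇒≢ p<q))

  blockColour : Fin n → Fin n → Fin (suc c)
  blockColour p q with Fin.<-cmp p q
  ... | tri< p<q _ _ = ordered p q p<q
  ... | tri≈ _ _ _ = zero
  ... | tri> _ _ q<p = ordered q p q<p

  blockColour-sym : ∀ p q → blockColour p q ≡ blockColour q p
  blockColour-sym p q with Fin.<-cmp p q | Fin.<-cmp q p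
  ... | tri< p<q _ _ | tri< q<p _ _ = ⊥-elim (Fin.<-asym p<q q<p)
  ... | tri< p<q _ _ | tri≈ _ q≡p _ = ⊥-elim (Fin.<⇒≢ p<q (sym q≡p))
  ... | tri< p<q _ _ | tri> _ _ p<q′ = cong (ordered p q) (Fin.<-irrelevant p<q p<q′)
  ... | tri≈ _ p≡q _ | tri< q<p _ _ = ⊥-elim (Fin.<⇒≢ q<p (sym p≡q))
  ... | tri≈ _ _ _ | tri≈ _ _ _ = refl
  ... | tri≈ _ p≡q _ | tri> _ _ p<q = ⊥-elim (Fin.<⇒≢ p<q p≡q)
  ... | tri> _ _ q<p | tri< q<p′ _ _ = cong (ordered q p) (Fin.<-irrelevant q<p q<p′)
  ... | tri> _ _ q<p | tri≈ _ q≡p _ = ⊥-elim (Fin.<⇒≢ q<p q≡p)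
  ... | tri> _ _ q<p | tri> _ _ p<q = ⊥-elim (Fin.<-asym p<q q<p)

  realise : ∀ p q → p ≢ q →
            ∃[ u ] ∃[ v ] (block P u ≡ p × block P v ≡ q × edge G u v ≡ just (blockColour p q))
  realise p q p≢q with Fin.<-cmp p q
  ... | tri< p<q _ _ = let l@(u , v , u∈p , v∈q , _) = joined p q (Fin.<⇒≢ p<q) in
                       u , v , u∈p , v∈q , colour-between-correct l
  ... | tri≈ _ p≡q _ = ⊥-elim (p≢q p≡q)
  ... | tri> _ _ q<p = let l@(u , v , u∈q , v∈p , _) = joined q p (Fin.<⇒≢ q<p) in
                       v , u , v∈p , u∈q , trans (ColouredGraph.sym G v u) (colour-between-correct l)

  open CompleteColouring blockColour blockColour-sym using (Matching)

  matching-in-G : ∀ {i k} → Matching ⊤ i k → MonoMatching G i k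
  matching-in-G {i} {k} (m , edges , disjoint) = m′ , coloured , disjoint′
    where
    lifted : ∀ a → ∃[ u ] ∃[ v ] (block P u ≡ proj₁ (m a) × block P v ≡ proj₂ (m a) ×
                                    edge G u v ≡ just (blockColour (proj₁ (m a)) (proj₂ (m a))))
    lifted a = realise (proj₁ (m a)) (proj₂ (m a)) (proj₁ (proj₂ (proj₂ (edges a))))

    m′ : Fin k → Fin N × Fin N
    m′ a = proj₁ (lifted a) , proj₁ (proj₂ (lifted a))

    coloured : ∀ a → edge G (proj₁ (m′ a)) (proj₂ (m′ a)) ≡ just i
    coloured a = let (_ , _ , _ , _ , uv≡ab) = lifted a ; (_ , _ , _ , ab≡i) = edges a in
                 trans uv≡ab (cong just ab≡i)

    different-blocks : ∀ {y z p q} → block P y ≡ p → block P z ≡ q → p ≢ q → y ≢ z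
    different-blocks refl refl p≢q refl = p≢q refl

    disjoint′ : ∀ a b → a ≢ b → Disjoint (m′ a) (m′ b)
    disjoint′ a b a≢b with disjoint a b a≢b | lifted a | lifted b
    ... | d₁ , d₂ , d₃ , d₄ | _ , _ , ua , va , _ | _ , _ , ub , vb , _ =
      different-blocks ua ub d₁ , different-blocks ua vb d₂ ,
      different-blocks va ub d₃ , different-blocks va vb d₄

corollary1 : (c' : ℕ) (ns : Fin (suc c') → ℕ) →
    (∀ i j → toℕ i ≤ toℕ j → ns j ≤ ns i) →
    (∀ i → 1 ≤ ns i) →
    (N : ℕ) (G : ColouredGraph N (suc c')) (n : ℕ) (P : Partition N n) →
    AllPairsJoined G P →
    ns zero + 1 + ΣFin (suc c') (λ i → ns i ∸ 1) ≤ n →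
    ∃[ i ] MonoMatching G i (ns i)
corollary1 c' ns sorted _ N G n P joined bound = map₂ matching-in-G monochromatic
  where
  open BlockColouring G P joined
  open CompleteColouring blockColour blockColour-sym using (Goal; cockayne-lorimer)

  monochromatic : Goal ⊤ ns
  monochromatic = cockayne-lorimer ns (ns zero) (λ i → sorted zero i z≤n) bound
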